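{- Let $G$ be a partial graph with a local coloring having no cusp-free cycle, and let $v$ be a vertex of $G$ which is not splitting. Then for every color $\alpha$ there exists a cusp-point $(u,\beta)$ such that $(v,\alpha)\lhd(u,\beta)$.
   Context: A partial graph is a triple $(\mathcal V,\mathcal E,\psi)$ of disjoint finite sets of vertices and edges and a function $\psi$ giving each edge a set of at most two endpoints. A path is an alternating sequence $(v_0,e_1,v_1,\dots,e_n,v_n)$ with the endpoints of $e_i$ exactly $v_{i-1}\neq v_i$; simple if edges are pairwise distinct and vertices pairwise distinct except possibly $v_0=v_n$; closed if $v_0=v_n$, open otherwise; a cycle is a simple closed path with at least one edge. A local coloring $\mathsf c$ assigns a color (from a finite set $\mathsf C$) to each pair $(e,w)$ with $w$ an endpoint of $e$. A cusp is a triple $(e,w,f)$ of distinct edges incident to $w$ with $\mathsf c(e,w)=\mathsf c(f,w)=\alpha$, and then $(w,\alpha)$ is a cusp-point. Cusps of a path: consecutive triples $(e_i,v_i,e_{i+1})$ that are cusps, and for a closed path also $(e_n,v_0,e_1)$. Cusp-free: no cusp. A vertex $v$ is splitting if every cycle containing $v$ has a cusp at $v$. Starting color $\mathsf c(e_1,v_0)$, ending color $\mathsf c(e_n,v_n)$. Write $(v,\alpha)\to_p(u,\beta)$ if $p$ is a simple open cusp-free path from $v$ to $u$ with starting color not $\alpha$ and ending color $\beta$; and $(v,\alpha)\lhd(u,\beta)$ if some such $p$ satisfies: for every vertex $x$, color $\tau$, path $q$ with $(u,\beta)\to_q(x,\tau)$, $x$ does not occur in $p$. -}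

module Defs where

open import Data.Nat using (ℕ; zero; suc; _≤_)
open import Data.Fin using (Fin; toℕ; _≟_) renaming (_<_ to _<ᶠ_)
open import Data.Fin.Subset using (Subset; ∣_∣) renaming (_∈_ to _∈ˢ_)
open import Data.List using (List; []; _∷_; [_]; map; length; lookup)
open import Data.List.Membership.Propositional using (_∈_; _∉_)
open import Data.List.Relation.Unary.Unique.Propositional using (Unique)
open import Data.Product using (_×_; _,_; proj₁; proj₂; ∃; ∃-syntax; Σ-syntax)
open import Data.Sum using (_⊎_)
open import Data.Empty using (⊥)
open import Data.Bool using (if_then_else_)
open import Relation.Nullary using (¬_)
open import Relation.Nullary.Decidable using (⌊_⌋)
open import Relation.Binary.PropositionalEquality using (_≡_; _≢_)
open import Function.Bundles using (_⇔_)

record PartialGraph : Set where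
  field
    nV nE     : ℕ
    ends      : Fin nE → Subset nV
    atMostTwo : ∀ e → ∣ ends e ∣ ≤ 2

open PartialGraph public

-- A local coloring with colors Fin k.  Only the values c e w with w an
-- endpoint of e are meaningful; all notions below only use those.
Coloring : PartialGraph → ℕ → Set
Coloring G k = Fin (nE G) → Fin (nV G) → Fin k

module _ (G : PartialGraph) {k : ℕ} (c : Coloring G k) where

  V E : Set
  V = Fin (nV G)
  E = Fin (nE G)

  IsCusp : E → V → E → Set
  IsCusp e w f = e ≢ f × w ∈ˢ ends G e × w ∈ˢ ends G f × c e w ≡ c f w

  CuspPoint : V → Fin k → Set
  CuspPoint w α = ∃[ e ] ∃[ f ] (IsCusp e w f × c e w ≡ α)

  -- A (candidate) path: v₀ followed by steps (e₁ , v₁) … (eₙ , vₙ)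
  record Path : Set where
    constructor mkPath
    field
      start : V
      steps : List (E × V)

  open Path public

  lastStep : E × V → List (E × V) → E × V
  lastStep s []       = s
  lastStep _ (t ∷ ts) = lastStep t ts

  endV : Path → V
  endV (mkPath v₀ [])       = v₀
  endV (mkPath _  (s ∷ ss)) = proj₂ (lastStep s ss)

  vertices : Path → List V
  vertices p = start p ∷ map proj₂ (steps p)

  edges : Path → List E
  edges p = map proj₁ (steps p)

  StepsOK : V → List (E × V) → Set
  StepsOK v []            = Data.Unit.⊤ where import Data.Unit
  StepsOK v ((e , w) ∷ s) =
    v ≢ w × (∀ x → (x ∈ˢ ends G e) ⇔ (x ≡ v ⊎ x ≡ w)) × StepsOK w s

  IsPath : Path → Set
  IsPath p = StepsOK (start p) (steps p)

  -- edges pairwise distinct; vertices pairwise distinct except possibly v₀ = vₙ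
  Simple : Path → Set
  Simple p = Unique (edges p) ×
    (∀ (i j : Fin (length (vertices p))) → i <ᶠ j →
       lookup (vertices p) i ≡ lookup (vertices p) j →
       toℕ i ≡ 0 × suc (toℕ j) ≡ length (vertices p))

  Closed : Path → Set
  Closed p = start p ≡ endV p

  Open : Path → Set
  Open p = ¬ Closed p

  innerTurns : List (E × V) → List (E × V × E)
  innerTurns ((e , w) ∷ (f , x) ∷ s) = (e , w , f) ∷ innerTurns ((f , x) ∷ s)
  innerTurns _                       = []

  closingTurn : V → List (E × V) → List (E × V × E)
  closingTurn v₀ []              = []
  closingTurn v₀ ((e₁ , w) ∷ ss) =
    if ⌊ proj₂ (lastStep (e₁ , w) ss) ≟ v₀ ⌋
    then [ (proj₁ (lastStep (e₁ , w) ss) , v₀ , e₁) ]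
    else []

  turns : Path → List (E × V × E)
  turns p = innerTurns (steps p) Data.List.++ closingTurn (start p) (steps p)
    where import Data.List

  CuspOf : Path → E → V → E → Set
  CuspOf p e w f = (e , w , f) ∈ turns p × IsCusp e w f

  CuspFree : Path → Set
  CuspFree p = ∀ e w f → ¬ CuspOf p e w f

  CuspAt : V → Path → Set
  CuspAt v p = ∃[ e ] ∃[ f ] CuspOf p e v f

  Cycle : Path → Set
  Cycle p = IsPath p × Simple p × Closed p × steps p ≢ []

  NoCuspFreeCycle : Set
  NoCuspFreeCycle = ∀ p → Cycle p → ¬ CuspFree p

  Splitting : V → Set
  Splitting v = ∀ p → Cycle p → v ∈ vertices p → CuspAt v p

  Arrow : V → Fin k → Path → V → Fin k → Set
  Arrow v α (mkPath v₀ [])       u β = ⊥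
  Arrow v α (mkPath v₀ (s ∷ ss)) u β =
    let p = mkPath v₀ (s ∷ ss) in
    IsPath p × Simple p × Open p × CuspFree p ×
    v₀ ≡ v × endV p ≡ u ×
    c (proj₁ s) v₀ ≢ α × c (proj₁ (lastStep s ss)) (endV p) ≡ β

  Lhd : V → Fin k → V → Fin k → Set
  Lhd v α u β = Σ[ p ∈ Path ] (Arrow v α p u β ×
    (∀ (x : V) (τ : Fin k) (q : Path) → Arrow u β q x τ → x ∉ vertices p))

-- Assume that no cusp-point (u , β) satisfies (v , α) ◁ (u , β); we show that v is splitting.
-- (This is constructive because the conclusion is decidable: only paths with at most as many
-- steps as there are vertices matter for ◁.) Let C be a cycle through v without a cusp at v,
-- rotated to start at v and, if necessary, reversed so that it leaves v in a colour other
-- than α. Scan C from v: while the scanned part ps is cusp-free it is an arrow (v , α) →ₚ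
-- (u , β) to its end u, with β the colour of its last edge at u. When the scan meets a cusp at
-- u, (u , β) is a cusp-point, so ◁ fails and some cusp-free path from (u , β) comes back to
-- ps. Follow it until it first meets C, at y. If y lies ahead on C, the path replaces the
-- part of C from u to y. If y lies on ps, the cycle made of ps from y to u and the path back
-- to y has a cusp, necessarily at y; this lets ps continue from y along the reversed path
-- instead, and the new cycle has no cusp at u. Either way the unscanned part of C shrinks,
-- so eventually C is cusp-free, contradicting the hypothesis.

module Submission where

open import Defs
open import Data.Nat using (ℕ)
open import Data.Fin using (Fin)
open import Data.Product using (∃-syntax; _×_)
open import Relation.Nullary using (¬_)

open import Data.Empty using (⊥; ⊥-elim)
open import Data.Unit using (⊤)
open import Data.Product using (_,_; proj₁; proj₂; ∃; ∃₂)
open import Data.Product.Properties using (≡-dec)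
open import Data.Sum using (_⊎_; inj₁; inj₂)
import Data.Sum as Sum
open import Data.Nat using (zero; suc; z≤n; s≤s; _<_; _≤_; _≤?_)
import Data.Nat as ℕ
open import Data.Nat.Properties using (suc-injective; <-irrefl; ≤-refl; ≤-trans; m≤n+m; n≤1+n; ≰⇒>)
open import Data.Nat.Induction using (<-wellFounded)
open import Data.Fin using (_≟_; zero; suc; toℕ; fromℕ) renaming (_<_ to _<ᶠ_)
open import Data.Fin.Properties using (toℕ-injective; toℕ-fromℕ; any?; all?; pigeonhole) renaming (_<?_ to _<ᶠ?_)
open import Data.Fin.Subset using () renaming (_∈_ to _∈ˢ_)
open import Data.Fin.Subset.Properties using () renaming (_∈?_ to _∈ˢ?_)
open import Data.List using (List; []; _∷_; [_]; _++_; map; reverse; lookup; length)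
open import Data.List.Properties using (++-assoc; ++-identityʳ; map-++; length-++; length-map; unfold-reverse)
open import Data.List.Membership.Propositional using (_∈_; _∉_)
open import Data.List.Membership.Propositional.Properties using (∈-++⁺ˡ; ∈-++⁺ʳ; ∈-++⁻; ∈-lookup)
import Data.List.Membership.DecPropositional as Membership
open import Data.List.Relation.Unary.Any as Any using (Any; here; there)
import Data.List.Relation.Unary.Any.Properties as Anyₚ
open import Data.List.Relation.Unary.All as All using (All; _∷_)
import Data.List.Relation.Unary.All.Properties as Allₚ
import Data.List.Relation.Unary.First as First
open import Data.List.Relation.Unary.First.Properties using (¬All⇒First; toView)
open import Data.List.Relation.Unary.Unique.Propositional using (Unique; []; _∷_)
import Data.List.Relation.Unary.AllPairs as AllPairs
import Data.List.Relation.Unary.Unique.Propositional.Properties as Uniqueₚ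
open import Data.List.Relation.Binary.Disjoint.Propositional using (Disjoint)
open import Data.List.Relation.Binary.Subset.Propositional using (_⊆_)
open import Data.List.Relation.Binary.Subset.Propositional.Properties using (++⁺ʳ; xs⊆ys++xs; xs⊆xs++ys; map⁺; ⊆-trans)
open import Data.List.Relation.Binary.Permutation.Propositional using (_↭_; ↭-sym; ↭-trans; ↭-reflexive; ↭⇒↭ₛ)
open import Data.List.Relation.Binary.Permutation.Propositional.Properties using (++-comm; shifts; ↭-reverse; drop-∷)
import Data.List.Relation.Binary.Permutation.Setoid.Properties as Permutationₛ
open import Function.Base using (_∘_; id; case_of_)
open import Function.Bundles using (_⇔_; Equivalence; mk⇔)
open import Induction.WellFounded using (Acc; acc)
open import Relation.Nullary using (Dec; yes; no)
open import Relation.Nullary.Decidable using (¬?; _×-dec_; _⊎-dec_; _→-dec_; map′; decidable-stable)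
open import Relation.Unary using (Pred; Decidable; ∁)
open import Relation.Binary.PropositionalEquality
  using (_≡_; _≢_; refl; sym; trans; cong; cong₂; subst; subst₂; setoid; module ≡-Reasoning)
open ≡-Reasoning

map-++-++ : ∀ {a b} {A : Set a} {B : Set b} (f : A → B) xs ys zs →
            map f (xs ++ ys ++ zs) ≡ map f xs ++ map f ys ++ map f zs
map-++-++ f xs ys zs = trans (map-++ f xs (ys ++ zs)) (cong (map f xs ++_) (map-++ f ys zs))

module _ {a} {A : Set a} where

  Unique-resp-↭ : {xs ys : List A} → xs ↭ ys → Unique xs → Unique ys
  Unique-resp-↭ p = Permutationₛ.Unique-resp-↭ (setoid A) (↭⇒↭ₛ p)

  Unique-++⁻ : ∀ xs {ys : List A} → Unique (xs ++ ys) → Unique xs × Unique ys × Disjoint xs ys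
  Unique-++⁻ []       u          = [] , u , λ ()
  Unique-++⁻ (x ∷ xs) (x∉ ∷ u) with Unique-++⁻ xs u
  ... | uxs , uys , xs#ys = Allₚ.++⁻ˡ xs x∉ ∷ uxs , uys , λ where
    (here refl , y∈ys) → Allₚ.All¬⇒¬Any (Allₚ.++⁻ʳ xs x∉) y∈ys
    (there y∈xs , y∈ys) → xs#ys (y∈xs , y∈ys)

  Unique-++-comm : ∀ xs {ys : List A} → Unique (xs ++ ys) → Unique (ys ++ xs)
  Unique-++-comm xs = Unique-resp-↭ (++-comm xs _)

  Unique-reverse : {xs : List A} → Unique xs → Unique (reverse xs)
  Unique-reverse {xs} = Unique-resp-↭ (↭-sym (↭-reverse xs))

  Unique-middle-disjoint : ∀ xs ys {zs : List A} → Unique (xs ++ ys ++ zs) → Disjoint ys (xs ++ zs)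
  Unique-middle-disjoint xs ys u = proj₂ (proj₂ (Unique-++⁻ ys (Unique-resp-↭ (shifts xs ys) u)))

  Unique-replace-middle : ∀ xs ys {zs ys′ : List A} → Unique (xs ++ ys ++ zs) →
                          Unique ys′ → Disjoint ys′ (xs ++ zs) → Unique (xs ++ ys′ ++ zs)
  Unique-replace-middle xs ys {ys′ = ys′} u uys′ ys′#xs++zs with Unique-++⁻ ys (Unique-resp-↭ (shifts xs ys) u)
  ... | _ , uxs++zs , _ = Unique-resp-↭ (shifts ys′ xs) (Uniqueₚ.++⁺ uys′ uxs++zs ys′#xs++zs)

  lookup-injective : ∀ {xs : List A} {i j} → Unique xs → lookup xs i ≡ lookup xs j → i ≡ j
  lookup-injective {x ∷ xs} {zero}  {zero}  _        _  = refl
  lookup-injective {x ∷ xs} {zero}  {suc j} (x∉ ∷ _) eq =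
    ⊥-elim (Allₚ.All¬⇒¬Any x∉ (subst (_∈ xs) (sym eq) (∈-lookup j)))
  lookup-injective {x ∷ xs} {suc i} {zero}  (x∉ ∷ _) eq =
    ⊥-elim (Allₚ.All¬⇒¬Any x∉ (subst (_∈ xs) eq (∈-lookup i)))
  lookup-injective {x ∷ xs} {suc i} {suc j} (_ ∷ u)  eq = cong suc (lookup-injective u eq)

  Unique-from-lookup : ∀ (xs : List A) → (∀ i j → i <ᶠ j → lookup xs i ≢ lookup xs j) → Unique xs
  Unique-from-lookup []       _        = []
  Unique-from-lookup (x ∷ xs) distinct =
    Allₚ.¬Any⇒All¬ xs (λ x∈xs → distinct zero (suc (Any.index x∈xs)) (s≤s z≤n) (Anyₚ.lookup-index x∈xs)) ∷
    Unique-from-lookup xs (λ i j i<j → distinct (suc i) (suc j) (s≤s i<j))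

  first-visit : ∀ {p} {P : Pred A p} → Decidable P → ∀ {xs} → Any P xs → First.FirstView (∁ P) P xs
  first-visit P? some =
    toView (¬All⇒First (¬? ∘ P?) (λ {x} → decidable-stable (P? x)) (λ none → Allₚ.All¬⇒¬Any none some))

Unique-length≤ : ∀ {n} {xs : List (Fin n)} → Unique xs → length xs ≤ n
Unique-length≤ {n} {xs} u with length xs ≤? n
... | yes ≤n = ≤n
... | no  >n with pigeonhole (≰⇒> >n) (lookup xs)
...   | i , j , i<j , same = ⊥-elim (<-irrefl (cong toℕ (lookup-injective u same)) i<j)

_⇔-dec_ : ∀ {a b} {A : Set a} {B : Set b} → Dec A → Dec B → Dec (A ⇔ B)
A? ⇔-dec B? = map′ (λ (to , from) → mk⇔ to from) (λ A⇔B → Equivalence.to A⇔B , Equivalence.from A⇔B)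
                   ((A? →-dec B?) ×-dec (B? →-dec A?))

module Walk (G : PartialGraph) {k : ℕ} (c : Coloring G k) where

  Vertex Edge Step : Set
  Vertex = Fin (nV G)
  Edge   = Fin (nE G)
  Step   = Edge × Vertex

  Cusp : Edge → Vertex → Edge → Set
  Cusp = IsCusp G c

  IsWalk : Vertex → List Step → Set
  IsWalk = StepsOK G c

  end : Vertex → List Step → Vertex
  end a xs = endV G c (mkPath a xs)

  targets : List Step → List Vertex
  targets = map proj₂

  edgesOf : List Step → List Edge
  edgesOf = map proj₁

  lastEdge : Step → List Step → Edge
  lastEdge x xs = proj₁ (lastStep G c x xs)

  -- OnFirstEdge P xs also says that xs is nonempty.
  OnFirstEdge : (Edge → Set) → List Step → Set
  OnFirstEdge P []            = ⊥
  OnFirstEdge P ((e , _) ∷ _) = P e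

  OnFirstEdge-map : ∀ {P Q : Edge → Set} xs → (∀ {e} → P e → Q e) → OnFirstEdge P xs → OnFirstEdge Q xs
  OnFirstEdge-map (_ ∷ _) f p = f p

  OnFirstEdge-≡ : ∀ {P : Edge → Set} {e} xs → OnFirstEdge (e ≡_) xs → OnFirstEdge P xs → P e
  OnFirstEdge-≡ (_ ∷ _) refl p = p

  OnFirstEdge-++ : ∀ {P : Edge → Set} xs {ys} → OnFirstEdge P xs → OnFirstEdge P (xs ++ ys)
  OnFirstEdge-++ (_ ∷ _) p = p

  OnFirstEdge-++-swap : ∀ {P : Edge → Set} xs {ys zs} → OnFirstEdge P (xs ++ ys) →
                        (xs ≡ [] → OnFirstEdge P ys → OnFirstEdge P zs) → OnFirstEdge P (xs ++ zs)
  OnFirstEdge-++-swap []      p swap = swap refl p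
  OnFirstEdge-++-swap (_ ∷ _) p _    = p

  end-∷ : ∀ a e w xs → end a ((e , w) ∷ xs) ≡ end w xs
  end-∷ a e w []      = refl
  end-∷ a e w (_ ∷ _) = refl

  end-++ : ∀ a xs ys → end a (xs ++ ys) ≡ end (end a xs) ys
  end-++ a []             ys = refl
  end-++ a ((e , w) ∷ xs) ys = begin
    end a ((e , w) ∷ xs ++ ys)     ≡⟨ end-∷ a e w (xs ++ ys) ⟩
    end w (xs ++ ys)               ≡⟨ end-++ w xs ys ⟩
    end (end w xs) ys              ≡⟨ cong (λ z → end z ys) (end-∷ a e w xs) ⟨
    end (end a ((e , w) ∷ xs)) ys  ∎

  end∈targets : ∀ a x xs → end a (x ∷ xs) ∈ targets (x ∷ xs)
  end∈targets a x []       = here refl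
  end∈targets a x (y ∷ ys) = there (end∈targets (proj₂ x) y ys)

  end∈vertices : ∀ a xs → end a xs ∈ a ∷ targets xs
  end∈vertices a []       = here refl
  end∈vertices a (x ∷ xs) = there (end∈targets a x xs)

  lastStep-++ : ∀ x xs y ys → lastStep G c x (xs ++ y ∷ ys) ≡ lastStep G c y ys
  lastStep-++ x []       y ys = refl
  lastStep-++ x (z ∷ xs) y ys = lastStep-++ z xs y ys

  lastStep-split : ∀ x xs A y ys → x ∷ xs ≡ A ++ y ∷ ys → lastStep G c x xs ≡ lastStep G c y ys
  lastStep-split x xs []      y ys refl = refl
  lastStep-split x xs (_ ∷ A) y ys refl = lastStep-++ x A y ys

  lastEdge∈ : ∀ x xs → lastEdge x xs ∈ edgesOf (x ∷ xs)
  lastEdge∈ x []       = here refl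
  lastEdge∈ x (y ∷ ys) = there (lastEdge∈ y ys)

  split-at-vertex : ∀ a xs {y} → y ∈ a ∷ targets xs → ∃₂ λ A B → xs ≡ A ++ B × end a A ≡ y
  split-at-vertex a xs             (here refl) = [] , xs , refl , refl
  split-at-vertex a ((e , w) ∷ xs) (there y∈) with split-at-vertex w xs y∈
  ... | A , B , refl , at-y = (e , w) ∷ A , B , refl , trans (end-∷ a e w A) at-y

  IsWalk-++⁻ : ∀ a xs {ys} → IsWalk a (xs ++ ys) → IsWalk a xs × IsWalk (end a xs) ys
  IsWalk-++⁻ a []             ok                  = _ , ok
  IsWalk-++⁻ a ((e , w) ∷ xs) (a≢w , ends≡ , ok) with IsWalk-++⁻ w xs ok
  ... | okxs , okys = (a≢w , ends≡ , okxs) , subst (λ z → IsWalk z _) (sym (end-∷ a e w xs)) okys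

  IsWalk-++⁺ : ∀ a xs {ys} → IsWalk a xs → IsWalk (end a xs) ys → IsWalk a (xs ++ ys)
  IsWalk-++⁺ a []             _                     okys = okys
  IsWalk-++⁺ a ((e , w) ∷ xs) (a≢w , ends≡ , okxs) okys =
    a≢w , ends≡ , IsWalk-++⁺ w xs okxs (subst (λ z → IsWalk z _) (end-∷ a e w xs) okys)

  start∈ends : ∀ {a x xs} → IsWalk a (x ∷ xs) → a ∈ˢ ends G (proj₁ x)
  start∈ends (_ , ends≡ , _) = Equivalence.from (ends≡ _) (inj₁ refl)

  end∈ends : ∀ {a} x xs → IsWalk a (x ∷ xs) → end a (x ∷ xs) ∈ˢ ends G (lastEdge x xs)
  end∈ends x []       (_ , ends≡ , _) = Equivalence.from (ends≡ _) (inj₂ refl)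
  end∈ends x (y ∷ ys) (_ , _ , ok)    = end∈ends y ys ok

  -- Cusps along a walk

  cusp-sym : ∀ {e w f} → Cusp e w f → Cusp f w e
  cusp-sym (e≢f , w∈e , w∈f , same) = (λ e≡f → e≢f (sym e≡f)) , w∈f , w∈e , sym same

  cusp-colour : ∀ {e w f} → Cusp e w f → c e w ≡ c f w
  cusp-colour (_ , _ , _ , same) = same

  cusp-trans : ∀ {e w f g} → Cusp e w f → Cusp f w g → e ≢ g → Cusp e w g
  cusp-trans (_ , w∈e , _ , ce≡cf) (_ , _ , w∈g , cf≡cg) e≢g = e≢g , w∈e , w∈g , trans ce≡cf cf≡cg

  cusp? : ∀ e w f → Dec (Cusp e w f)
  cusp? e w f = ¬? (e ≟ f) ×-dec (w ∈ˢ? ends G e) ×-dec (w ∈ˢ? ends G f) ×-dec (c e w ≟ c f w)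

  SmoothInto : List Step → Edge → Set
  SmoothInto []       f = ⊤
  SmoothInto (x ∷ xs) f = ¬ Cusp (lastEdge x xs) (proj₂ (lastStep G c x xs)) f

  NoCuspAtJoin : List Step → List Step → Set
  NoCuspAtJoin xs []            = ⊤
  NoCuspAtJoin xs ((f , _) ∷ _) = SmoothInto xs f

  NoInnerCusp : List Step → Set
  NoInnerCusp ((e , w) ∷ (f , x) ∷ xs) = ¬ Cusp e w f × NoInnerCusp ((f , x) ∷ xs)
  NoInnerCusp _                        = ⊤

  SmoothInto-++ˡ : ∀ xs y ys f → SmoothInto (xs ++ y ∷ ys) f ≡ SmoothInto (y ∷ ys) f
  SmoothInto-++ˡ []       y ys f = refl
  SmoothInto-++ˡ (x ∷ xs) y ys f = cong (λ t → ¬ Cusp (proj₁ t) (proj₂ t) f) (lastStep-++ x xs y ys)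

  SmoothInto-replace : ∀ a xs {f g} → Cusp g (end a xs) f → f ∉ edgesOf xs → SmoothInto xs f → SmoothInto xs g
  SmoothInto-replace a []       _      _    _      = _
  SmoothInto-replace a (x ∷ xs) g≈f f∉xs smooth cusp =
    smooth (cusp-trans cusp g≈f (λ last≡f → f∉xs (subst (_∈ edgesOf (x ∷ xs)) last≡f (lastEdge∈ x xs))))

  NoCuspAtJoin-into : ∀ xs ys → OnFirstEdge (SmoothInto xs) ys → NoCuspAtJoin xs ys
  NoCuspAtJoin-into xs (_ ∷ _) smooth = smooth

  NoInnerCusp-++⁻ : ∀ xs {ys} → NoInnerCusp (xs ++ ys) → NoInnerCusp xs × NoCuspAtJoin xs ys × NoInnerCusp ys
  NoInnerCusp-++⁻ []            {[]}     nc       = _ , _ , nc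
  NoInnerCusp-++⁻ []            {_ ∷ _}  nc       = _ , _ , nc
  NoInnerCusp-++⁻ (x ∷ [])      {[]}     _        = _ , _ , _
  NoInnerCusp-++⁻ (x ∷ [])      {y ∷ ys} (j , nc) = _ , j , nc
  NoInnerCusp-++⁻ (x ∷ x′ ∷ xs) {ys}     (j , nc) with NoInnerCusp-++⁻ (x′ ∷ xs) nc
  ... | ncxs , jn , ncys = (j , ncxs) , NoCuspAtJoin-∷ ys jn , ncys
    where
    NoCuspAtJoin-∷ : ∀ ys → NoCuspAtJoin (x′ ∷ xs) ys → NoCuspAtJoin (x ∷ x′ ∷ xs) ys
    NoCuspAtJoin-∷ []      _  = _
    NoCuspAtJoin-∷ (_ ∷ _) jn = jn

  NoInnerCusp-++⁺ : ∀ xs {ys} → NoInnerCusp xs → NoCuspAtJoin xs ys → NoInnerCusp ys → NoInnerCusp (xs ++ ys)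
  NoInnerCusp-++⁺ []                     _          _  ncys = ncys
  NoInnerCusp-++⁺ (x ∷ [])      {[]}     _          _  _    = _
  NoInnerCusp-++⁺ (x ∷ [])      {y ∷ ys} _          jn ncys = jn , ncys
  NoInnerCusp-++⁺ (x ∷ x′ ∷ xs) {ys}     (j , ncxs) jn ncys =
    j , NoInnerCusp-++⁺ (x′ ∷ xs) ncxs (NoCuspAtJoin-∷⁻ ys jn) ncys
    where
    NoCuspAtJoin-∷⁻ : ∀ ys → NoCuspAtJoin (x ∷ x′ ∷ xs) ys → NoCuspAtJoin (x′ ∷ xs) ys
    NoCuspAtJoin-∷⁻ []      _  = _
    NoCuspAtJoin-∷⁻ (_ ∷ _) jn = jn

  -- Reversed walks

  reverseWalk : Vertex → List Step → List Step
  reverseWalk a []             = []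
  reverseWalk a ((e , w) ∷ xs) = reverseWalk w xs ++ [ (e , a) ]

  reverseWalk-snoc : ∀ a xs e w → reverseWalk a (xs ++ [ (e , w) ]) ≡ (e , end a xs) ∷ reverseWalk a xs
  reverseWalk-snoc a []              e w = refl
  reverseWalk-snoc a ((e′ , w′) ∷ xs) e w
    rewrite reverseWalk-snoc w′ xs e w | end-∷ a e′ w′ xs = refl

  reverseWalk-first : ∀ a x xs → OnFirstEdge (lastEdge x xs ≡_) (reverseWalk a (x ∷ xs))
  reverseWalk-first a x []       = refl
  reverseWalk-first a x (y ∷ ys) = OnFirstEdge-++ (reverseWalk (proj₂ x) (y ∷ ys)) (reverseWalk-first (proj₂ x) y ys)

  end-reverseWalk : ∀ a xs → end (end a xs) (reverseWalk a xs) ≡ a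
  end-reverseWalk a []             = refl
  end-reverseWalk a ((e , w) ∷ xs) = end-++ _ (reverseWalk w xs) [ (e , a) ]

  IsWalk-reverse : ∀ a xs → IsWalk a xs → IsWalk (end a xs) (reverseWalk a xs)
  IsWalk-reverse a []             _                    = _
  IsWalk-reverse a ((e , w) ∷ xs) (a≢w , ends≡ , okxs) =
    subst (λ z → IsWalk z (reverseWalk a ((e , w) ∷ xs))) (sym (end-∷ a e w xs))
      (IsWalk-++⁺ (end w xs) (reverseWalk w xs) (IsWalk-reverse w xs okxs)
        (subst (λ z → IsWalk z [ (e , a) ]) (sym (end-reverseWalk w xs)) back))
    where
    back : IsWalk w [ (e , a) ]
    back = (λ w≡a → a≢w (sym w≡a)) ,
           (λ x → mk⇔ (λ x∈e → Sum.swap (Equivalence.to (ends≡ x) x∈e))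
                      (λ x≡ → Equivalence.from (ends≡ x) (Sum.swap x≡))) , _

  targets-reverseWalk : ∀ a xs → end a xs ∷ targets (reverseWalk a xs) ≡ reverse (a ∷ targets xs)
  targets-reverseWalk a []             = refl
  targets-reverseWalk a ((e , w) ∷ xs) = begin
    end a ((e , w) ∷ xs) ∷ targets (reverseWalk w xs ++ [ (e , a) ])
      ≡⟨ cong₂ _∷_ (end-∷ a e w xs) (map-++ proj₂ (reverseWalk w xs) [ (e , a) ]) ⟩
    (end w xs ∷ targets (reverseWalk w xs)) ++ [ a ]
      ≡⟨ cong (_++ [ a ]) (targets-reverseWalk w xs) ⟩
    reverse (w ∷ targets xs) ++ [ a ]
      ≡⟨ unfold-reverse a (w ∷ targets xs) ⟨
    reverse (a ∷ w ∷ targets xs) ∎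

  targets-reverseWalk⊆ : ∀ a xs {z} → z ∈ targets (reverseWalk a xs) → z ∈ a ∷ targets xs
  targets-reverseWalk⊆ a xs z∈ = Anyₚ.reverse⁻ (subst (_ ∈_) (targets-reverseWalk a xs) (there z∈))

  edgesOf-reverseWalk : ∀ a xs → edgesOf (reverseWalk a xs) ≡ reverse (edgesOf xs)
  edgesOf-reverseWalk a []             = refl
  edgesOf-reverseWalk a ((e , w) ∷ xs) = begin
    edgesOf (reverseWalk w xs ++ [ (e , a) ]) ≡⟨ map-++ proj₁ (reverseWalk w xs) [ (e , a) ] ⟩
    edgesOf (reverseWalk w xs) ++ [ e ]       ≡⟨ cong (_++ [ e ]) (edgesOf-reverseWalk w xs) ⟩
    reverse (edgesOf xs) ++ [ e ]             ≡⟨ unfold-reverse e (edgesOf xs) ⟨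
    reverse (e ∷ edgesOf xs)                  ∎

  NoInnerCusp-reverse : ∀ a xs → NoInnerCusp xs → NoInnerCusp (reverseWalk a xs)
  NoInnerCusp-reverse a []                        _        = _
  NoInnerCusp-reverse a ((e , w) ∷ [])            _        = _
  NoInnerCusp-reverse a ((e , w) ∷ (f , x) ∷ xs) (j , nc) =
    NoInnerCusp-++⁺ (reverseWalk x xs ++ [ (f , w) ]) (NoInnerCusp-reverse w ((f , x) ∷ xs) nc)
      (subst id (sym (SmoothInto-++ˡ (reverseWalk x xs) (f , w) [] e)) (j ∘ cusp-sym)) _

  SmoothInto-reverse : ∀ a xs {f} → OnFirstEdge (λ e → ¬ Cusp e a f) xs → SmoothInto (reverseWalk a xs) f
  SmoothInto-reverse a ((e , w) ∷ xs) {f} smooth = subst id (sym (SmoothInto-++ˡ (reverseWalk w xs) (e , a) [] f)) smooth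

  -- Locating an edge on a walk

  -- Hop a xs e x y: the walk from a along xs crosses e from x to y.
  data Hop : Vertex → List Step → Edge → Vertex → Vertex → Set where
    here  : ∀ {a e w xs} → Hop a ((e , w) ∷ xs) e a w
    there : ∀ {a e w xs f x y} → Hop w xs f x y → Hop a ((e , w) ∷ xs) f x y

  hop⁺ : ∀ a xs {e} → e ∈ edgesOf xs → ∃₂ (Hop a xs e)
  hop⁺ a (_ ∷ xs) (here refl) = _ , _ , here
  hop⁺ a (_ ∷ xs) (there e∈) with hop⁺ _ xs e∈
  ... | x , y , h = x , y , there h

  hop-source∈ends : ∀ {a xs e x y} → IsWalk a xs → Hop a xs e x y → x ∈ˢ ends G e
  hop-source∈ends (_ , ends≡ , _) here      = Equivalence.from (ends≡ _) (inj₁ refl)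
  hop-source∈ends (_ , _ , ok)     (there h) = hop-source∈ends ok h

  hop-ends : ∀ {a xs e x y z} → IsWalk a xs → Hop a xs e x y → z ∈ˢ ends G e → z ≡ x ⊎ z ≡ y
  hop-ends (_ , ends≡ , _) here      z∈e = Equivalence.to (ends≡ _) z∈e
  hop-ends (_ , _ , ok)     (there h) z∈e = hop-ends ok h z∈e

  hop-source∈ : ∀ {a xs e x y} → Hop a xs e x y → x ∈ a ∷ targets xs
  hop-source∈ here      = here refl
  hop-source∈ (there h) = there (hop-source∈ h)

  hop-target∈ : ∀ {a xs e x y} → Hop a xs e x y → y ∈ targets xs
  hop-target∈ here      = here refl
  hop-target∈ (there h) = there (hop-target∈ h)

  hop-source∈-snoc : ∀ {a} xs {z e x y} → Hop a (xs ++ [ z ]) e x y → x ∈ a ∷ targets xs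
  hop-source∈-snoc []       here       = here refl
  hop-source∈-snoc (_ ∷ xs) here       = here refl
  hop-source∈-snoc (_ ∷ xs) (there h)  = there (hop-source∈-snoc xs h)

  hop-++ : ∀ {a} xs {ys e x y} → Hop a (xs ++ ys) e x y → Hop a xs e x y ⊎ Hop (end a xs) ys e x y
  hop-++                 []             h         = inj₂ h
  hop-++                 ((e , w) ∷ xs) here      = inj₁ here
  hop-++ {a} ((e , w) ∷ xs) {ys} (there h) with hop-++ xs h
  ... | inj₁ h′ = inj₁ (there h′)
  ... | inj₂ h′ = inj₂ (subst (λ z → Hop z ys _ _ _) (sym (end-∷ a e w xs)) h′)

  hop-from-start : ∀ {a xs e y} → Hop a xs e a y → a ∉ targets xs → OnFirstEdge (e ≡_) xs
  hop-from-start here      _   = refl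
  hop-from-start (there h) a∉ = ⊥-elim (a∉ (hop-source∈ h))

  hop-into-end : ∀ {a} x xs {e w} → Hop a (x ∷ xs) e w (end a (x ∷ xs)) → Unique (targets (x ∷ xs)) →
                 e ≡ lastEdge x xs
  hop-into-end x []       here      _          = refl
  hop-into-end x (y ∷ ys) here      (w∉ ∷ _)   = ⊥-elim (Allₚ.All¬⇒¬Any w∉ (end∈targets (proj₂ x) y ys))
  hop-into-end x (y ∷ ys) (there h) (_ ∷ uniq) = hop-into-end y ys h uniq

  hop-from-end : ∀ {a xs e y} → Hop a xs e (end a xs) y → Unique (a ∷ targets xs) → ⊥
  hop-from-end {a} {x ∷ xs} here      (a∉ ∷ _)   = Allₚ.All¬⇒¬Any a∉ (end∈targets a x xs)
  hop-from-end {a} {x ∷ xs} (there h) (_ ∷ uniq) =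
    hop-from-end (subst (λ z → Hop _ xs _ z _) (end-∷ a (proj₁ x) (proj₂ x) xs) h) uniq

  edge-endpoint∈ : ∀ {a xs e z} → IsWalk a xs → e ∈ edgesOf xs → z ∈ˢ ends G e → z ∈ a ∷ targets xs
  edge-endpoint∈ {a} {xs} ok e∈ z∈e with hop⁺ a xs e∈
  ... | x , y , h with hop-ends ok h z∈e
  ...   | inj₁ refl = hop-source∈ h
  ...   | inj₂ refl = there (hop-target∈ h)

  edge-at-start : ∀ {a xs e} → IsWalk a xs → a ∉ targets xs → e ∈ edgesOf xs → a ∈ˢ ends G e →
                  OnFirstEdge (e ≡_) xs
  edge-at-start {a} {xs} ok a∉ e∈ a∈e with hop⁺ a xs e∈
  ... | x , y , h with hop-ends ok h a∈e
  ...   | inj₁ refl = hop-from-start h a∉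
  ...   | inj₂ refl = ⊥-elim (a∉ (hop-target∈ h))

  edge-source-snoc : ∀ {a} xs {z e} → IsWalk a (xs ++ [ z ]) → e ∈ edgesOf (xs ++ [ z ]) →
                     ∃[ x ] (x ∈ˢ ends G e × x ∈ a ∷ targets xs)
  edge-source-snoc {a} xs ok e∈ with hop⁺ a (xs ++ [ _ ]) e∈
  ... | x , _ , h = x , hop-source∈ends ok h , hop-source∈-snoc xs h

  -- Simple walks and cycles

  record SimpleWalk (a : Vertex) (xs : List Step) : Set where
    field
      walk              : IsWalk a xs
      distinct-vertices : Unique (a ∷ targets xs)
      distinct-edges    : Unique (edgesOf xs)

  vertices-++⁻ : ∀ a xs {ys} → Unique (a ∷ targets (xs ++ ys)) →
                 Unique (a ∷ targets xs) × Unique (targets ys) × Disjoint (a ∷ targets xs) (targets ys)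
  vertices-++⁻ a xs {ys} u = Unique-++⁻ (a ∷ targets xs) (subst (λ t → Unique (a ∷ t)) (map-++ proj₂ xs ys) u)

  SimpleWalk-++⁻ˡ : ∀ {a} xs {ys} → SimpleWalk a (xs ++ ys) → SimpleWalk a xs
  SimpleWalk-++⁻ˡ {a} xs {ys} sw = record
    { walk              = proj₁ (IsWalk-++⁻ a xs walk)
    ; distinct-vertices = proj₁ (vertices-++⁻ a xs distinct-vertices)
    ; distinct-edges    = proj₁ (Unique-++⁻ (edgesOf xs) (subst Unique (map-++ proj₁ xs ys) distinct-edges))
    }
    where open SimpleWalk sw

  SimpleWalk-++⁻ʳ : ∀ {a} xs {ys} → SimpleWalk a (xs ++ ys) → SimpleWalk (end a xs) ys
  SimpleWalk-++⁻ʳ {a} xs {ys} sw = record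
    { walk              = proj₂ (IsWalk-++⁻ a xs walk)
    ; distinct-vertices = Allₚ.¬Any⇒All¬ _ (λ end∈ys → xs#ys (end∈vertices a xs , end∈ys)) ∷ uys
    ; distinct-edges    = proj₁ (proj₂ (Unique-++⁻ (edgesOf xs) (subst Unique (map-++ proj₁ xs ys) distinct-edges)))
    }
    where
    open SimpleWalk sw
    uys : Unique (targets ys)
    uys = proj₁ (proj₂ (vertices-++⁻ a xs distinct-vertices))
    xs#ys : Disjoint (a ∷ targets xs) (targets ys)
    xs#ys = proj₂ (proj₂ (vertices-++⁻ a xs distinct-vertices))

  SimpleWalk-reverse : ∀ {a xs} → SimpleWalk a xs → SimpleWalk (end a xs) (reverseWalk a xs)
  SimpleWalk-reverse {a} {xs} sw = record
    { walk              = IsWalk-reverse a xs walk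
    ; distinct-vertices = subst Unique (sym (targets-reverseWalk a xs)) (Unique-reverse distinct-vertices)
    ; distinct-edges    = subst Unique (sym (edgesOf-reverseWalk a xs)) (Unique-reverse distinct-edges)
    }
    where open SimpleWalk sw

  SimpleWalk-open : ∀ {a x xs} → SimpleWalk a (x ∷ xs) → a ≢ end a (x ∷ xs)
  SimpleWalk-open {a} {x} {xs} sw a≡end with SimpleWalk.distinct-vertices sw
  ... | a∉ ∷ _ = Allₚ.All¬⇒¬Any a∉ (subst (_∈ targets (x ∷ xs)) (sym a≡end) (end∈targets a x xs))

  record CycleAt (a : Vertex) (xs : List Step) : Set where
    field
      walk              : IsWalk a xs
      closed            : end a xs ≡ a
      distinct-vertices : Unique (targets xs)
      distinct-edges    : Unique (edgesOf xs)

  CycleAt-prefix : ∀ {a} P s S → CycleAt a (P ++ s ∷ S) → SimpleWalk a P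
  CycleAt-prefix {a} P s S cyc = record
    { walk              = proj₁ (IsWalk-++⁻ a P walk)
    ; distinct-vertices = Allₚ.¬Any⇒All¬ _ (λ a∈P → P#S (a∈P , a∈S)) ∷ proj₁ split
    ; distinct-edges    = proj₁ (Unique-++⁻ (edgesOf P) (subst Unique (map-++ proj₁ P (s ∷ S)) distinct-edges))
    }
    where
    open CycleAt cyc
    split : Unique (targets P) × Unique (targets (s ∷ S)) × Disjoint (targets P) (targets (s ∷ S))
    split = Unique-++⁻ (targets P) (subst Unique (map-++ proj₂ P (s ∷ S)) distinct-vertices)
    P#S : Disjoint (targets P) (targets (s ∷ S))
    P#S = proj₂ (proj₂ split)
    a∈S : a ∈ targets (s ∷ S)
    a∈S = subst (_∈ targets (s ∷ S)) (trans (sym (end-++ a P (s ∷ S))) closed) (end∈targets (end a P) s S)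

  CycleAt-last≢first : ∀ {a} x xs → CycleAt a (x ∷ xs) → lastEdge x xs ≢ proj₁ x
  CycleAt-last≢first x []       cyc _     = proj₁ (CycleAt.walk cyc) (sym (CycleAt.closed cyc))
  CycleAt-last≢first x (y ∷ ys) cyc ℓ≡x =
    Uniqueₚ.Unique[x∷xs]⇒x∉xs (CycleAt.distinct-edges cyc) (subst (_∈ edgesOf (y ∷ ys)) ℓ≡x (lastEdge∈ y ys))

  CycleAt-junction : ∀ {a} p P s S {e} → CycleAt a ((p ∷ P) ++ (s ∷ S)) →
                     e ∈ edgesOf ((p ∷ P) ++ (s ∷ S)) → end a (p ∷ P) ∈ˢ ends G e →
                     e ≡ lastEdge p P ⊎ e ≡ proj₁ s
  CycleAt-junction {a} p P s S {e} cyc e∈ w∈e = by-hop (hop⁺ a ((p ∷ P) ++ (s ∷ S)) e∈)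
    where
    open CycleAt cyc
    w : Vertex
    w = end a (p ∷ P)
    P-simple : Unique (a ∷ targets (p ∷ P))
    P-simple = SimpleWalk.distinct-vertices (CycleAt-prefix (p ∷ P) s S cyc)
    P#S : Disjoint (targets (p ∷ P)) (targets (s ∷ S))
    P#S = proj₂ (proj₂ (Unique-++⁻ (targets (p ∷ P))
            (subst Unique (map-++ proj₂ (p ∷ P) (s ∷ S)) distinct-vertices)))
    w∉S : w ∉ targets (s ∷ S)
    w∉S w∈S = P#S (end∈targets a p P , w∈S)
    by-hop : ∃₂ (Hop a ((p ∷ P) ++ (s ∷ S)) e) → e ≡ lastEdge p P ⊎ e ≡ proj₁ s
    by-hop (x , y , h) with hop-ends walk h w∈e | hop-++ (p ∷ P) h
    ... | inj₁ refl | inj₁ hP = ⊥-elim (hop-from-end hP P-simple)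
    ... | inj₂ refl | inj₁ hP = inj₁ (hop-into-end p P hP (AllPairs.tail P-simple))
    ... | inj₁ refl | inj₂ hS = inj₂ (hop-from-start hS w∉S)
    ... | inj₂ refl | inj₂ hS = ⊥-elim (w∉S (hop-target∈ hS))

  CycleAt-rotate : ∀ {a} xs {ys} → CycleAt a (xs ++ ys) → CycleAt (end a xs) (ys ++ xs)
  CycleAt-rotate {a} xs {ys} cyc = record
    { walk              = IsWalk-++⁺ (end a xs) ys okys (subst (λ z → IsWalk z xs) (sym ys-returns) okxs)
    ; closed            = trans (end-++ (end a xs) ys xs) (cong (λ z → end z xs) ys-returns)
    ; distinct-vertices = subst Unique (sym (map-++ proj₂ ys xs))
                            (Unique-++-comm (targets xs) (subst Unique (map-++ proj₂ xs ys) distinct-vertices))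
    ; distinct-edges    = subst Unique (sym (map-++ proj₁ ys xs))
                            (Unique-++-comm (edgesOf xs) (subst Unique (map-++ proj₁ xs ys) distinct-edges))
    }
    where
    open CycleAt cyc
    okxs : IsWalk a xs
    okxs = proj₁ (IsWalk-++⁻ a xs walk)
    okys : IsWalk (end a xs) ys
    okys = proj₂ (IsWalk-++⁻ a xs walk)
    ys-returns : end (end a xs) ys ≡ a
    ys-returns = trans (sym (end-++ a xs ys)) closed

  CycleAt-reverse : ∀ {a xs} → CycleAt a xs → CycleAt a (reverseWalk a xs)
  CycleAt-reverse {a} {xs} cyc = record
    { walk              = subst (λ z → IsWalk z (reverseWalk a xs)) closed (IsWalk-reverse a xs walk)
    ; closed            = subst (λ z → end z (reverseWalk a xs) ≡ a) closed (end-reverseWalk a xs)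
    ; distinct-vertices = Unique-resp-↭ (↭-sym targets↭) distinct-vertices
    ; distinct-edges    = subst Unique (sym (edgesOf-reverseWalk a xs)) (Unique-reverse distinct-edges)
    }
    where
    open CycleAt cyc
    targets↭ : targets (reverseWalk a xs) ↭ targets xs
    targets↭ = drop-∷ (↭-trans
      (↭-reflexive (trans (cong (_∷ targets (reverseWalk a xs)) (sym closed)) (targets-reverseWalk a xs)))
      (↭-reverse (a ∷ targets xs)))

  CycleAt-splice : ∀ {a} P m M S {M′} → CycleAt a (P ++ (m ∷ M) ++ S) →
                   SimpleWalk (end a P) M′ → end (end a P) M′ ≡ end (end a P) (m ∷ M) →
                   (∀ {z} → z ∈ targets M′ → z ∈ targets (P ++ (m ∷ M) ++ S) → z ≡ end (end a P) (m ∷ M)) →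
                   Disjoint (edgesOf M′) (edgesOf (P ++ (m ∷ M) ++ S)) →
                   CycleAt a (P ++ M′ ++ S)
  CycleAt-splice {a} P m M S {M′} cyc sw same-end meets-only-at-end fresh-edges = record
    { walk              = IsWalk-++⁺ a P okP (IsWalk-++⁺ x M′ (SimpleWalk.walk sw)
                            (subst (λ z → IsWalk z S) (sym same-end) okS))
    ; closed            = begin
        end a (P ++ M′ ++ S)          ≡⟨ end-++ a P (M′ ++ S) ⟩
        end x (M′ ++ S)               ≡⟨ end-++ x M′ S ⟩
        end (end x M′) S              ≡⟨ cong (λ z → end z S) same-end ⟩
        end (end x (m ∷ M)) S         ≡⟨ end-++ x (m ∷ M) S ⟨
        end x ((m ∷ M) ++ S)          ≡⟨ end-++ a P ((m ∷ M) ++ S) ⟨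
        end a (P ++ (m ∷ M) ++ S)     ≡⟨ closed ⟩
        a                             ∎
    ; distinct-vertices = subst Unique (sym (map-++-++ proj₂ P M′ S))
        (Unique-replace-middle (targets P) (targets (m ∷ M)) uV uM′ new-vertices)
    ; distinct-edges    = subst Unique (sym (map-++-++ proj₁ P M′ S))
        (Unique-replace-middle (edgesOf P) (edgesOf (m ∷ M)) uE (SimpleWalk.distinct-edges sw) new-edges)
    }
    where
    open CycleAt cyc
    x : Vertex
    x = end a P
    okP : IsWalk a P
    okP = proj₁ (IsWalk-++⁻ a P walk)
    okS : IsWalk (end x (m ∷ M)) S
    okS = proj₂ (IsWalk-++⁻ x (m ∷ M) (proj₂ (IsWalk-++⁻ a P walk)))
    uV : Unique (targets P ++ targets (m ∷ M) ++ targets S)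
    uV = subst Unique (map-++-++ proj₂ P (m ∷ M) S) distinct-vertices
    uE : Unique (edgesOf P ++ edgesOf (m ∷ M) ++ edgesOf S)
    uE = subst Unique (map-++-++ proj₁ P (m ∷ M) S) distinct-edges
    uM′ : Unique (targets M′)
    uM′ = AllPairs.tail (SimpleWalk.distinct-vertices sw)
    new-vertices : Disjoint (targets M′) (targets P ++ targets S)
    new-vertices (z∈M′ , z∈PS) with meets-only-at-end z∈M′
      (subst (_ ∈_) (sym (map-++-++ proj₂ P (m ∷ M) S))
        (++⁺ʳ (targets P) (xs⊆ys++xs _ (targets (m ∷ M))) z∈PS))
    ... | refl = Unique-middle-disjoint (targets P) (targets (m ∷ M)) uV (end∈targets x m M , z∈PS)
    new-edges : Disjoint (edgesOf M′) (edgesOf P ++ edgesOf S)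
    new-edges (e∈M′ , e∈PS) = fresh-edges
      (e∈M′ , subst (_ ∈_) (sym (map-++-++ proj₁ P (m ∷ M) S))
                (++⁺ʳ (edgesOf P) (xs⊆ys++xs _ (edgesOf (m ∷ M))) e∈PS))

  CycleAt-append : ∀ {x} M {M′} → SimpleWalk x M → SimpleWalk (end x M) M′ → end (end x M) M′ ≡ x →
                   (∀ {z} → z ∈ targets M′ → z ∈ x ∷ targets M → z ≡ x) →
                   Disjoint (edgesOf M′) (edgesOf M) →
                   CycleAt x (M ++ M′)
  CycleAt-append {x} M {M′} sw sw′ returns meets-only-at-start fresh-edges = record
    { walk              = IsWalk-++⁺ x M (SimpleWalk.walk sw) (SimpleWalk.walk sw′)
    ; closed            = trans (end-++ x M M′) returns
    ; distinct-vertices = subst Unique (sym (map-++ proj₂ M M′)) (Uniqueₚ.++⁺ uM uM′ new-vertices)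
    ; distinct-edges    = subst Unique (sym (map-++ proj₁ M M′))
        (Uniqueₚ.++⁺ (SimpleWalk.distinct-edges sw) (SimpleWalk.distinct-edges sw′)
                     (λ (e∈M , e∈M′) → fresh-edges (e∈M′ , e∈M)))
    }
    where
    x∉M : x ∉ targets M
    x∉M = Uniqueₚ.Unique[x∷xs]⇒x∉xs (SimpleWalk.distinct-vertices sw)
    uM : Unique (targets M)
    uM = AllPairs.tail (SimpleWalk.distinct-vertices sw)
    uM′ : Unique (targets M′)
    uM′ = AllPairs.tail (SimpleWalk.distinct-vertices sw′)
    new-vertices : Disjoint (targets M) (targets M′)
    new-vertices (z∈M , z∈M′) with meets-only-at-start z∈M′ (there z∈M)
    ... | refl = x∉M z∈M

  -- Agreement with Simple, Cycle, CuspFree and Arrow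

  lookup-last : ∀ a xs {j} → suc (toℕ j) ≡ length (a ∷ targets xs) → lookup (a ∷ targets xs) j ≡ end a xs
  lookup-last a xs {j} j-last = trans
    (cong (lookup (a ∷ targets xs)) (toℕ-injective (trans (suc-injective j-last) (sym (toℕ-fromℕ _)))))
    (lookup-end a xs)
    where
    lookup-end : ∀ a xs → lookup (a ∷ targets xs) (fromℕ (length (targets xs))) ≡ end a xs
    lookup-end a []             = refl
    lookup-end a ((e , w) ∷ xs) = trans (lookup-end w xs) (sym (end-∷ a e w xs))

  Simple⇒SimpleWalk : ∀ {a xs} → IsPath G c (mkPath a xs) → Simple G c (mkPath a xs) → Open G c (mkPath a xs) →
                      SimpleWalk a xs
  Simple⇒SimpleWalk {a} {xs} ok (distinct-edges , repeats-only-at-ends) open′ = record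
    { walk              = ok
    ; distinct-vertices = Unique-from-lookup (a ∷ targets xs) distinct
    ; distinct-edges    = distinct-edges
    }
    where
    distinct : ∀ i j → i <ᶠ j → lookup (a ∷ targets xs) i ≢ lookup (a ∷ targets xs) j
    distinct i j i<j same with repeats-only-at-ends i j i<j same
    distinct zero    j i<j same | _  , j-last = open′ (trans same (lookup-last a xs j-last))
    distinct (suc i) j i<j same | () , _

  SimpleWalk⇒Simple : ∀ {a xs} → SimpleWalk a xs → Simple G c (mkPath a xs)
  SimpleWalk⇒Simple sw = distinct-edges , λ i j i<j same →
    ⊥-elim (<-irrefl (cong toℕ (lookup-injective distinct-vertices same)) i<j)
    where open SimpleWalk sw

  Cycle⇒CycleAt : ∀ {a xs} → Cycle G c (mkPath a xs) → CycleAt a xs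
  Cycle⇒CycleAt {a} {xs} (ok , (distinct-edges , repeats-only-at-ends) , closed′ , _) = record
    { walk              = ok
    ; closed            = sym closed′
    ; distinct-vertices = Unique-from-lookup (targets xs) λ i j i<j same →
        case proj₁ (repeats-only-at-ends (suc i) (suc j) (s≤s i<j) same) of λ ()
    ; distinct-edges    = distinct-edges
    }

  CycleAt⇒Cycle : ∀ {a x xs} → CycleAt a (x ∷ xs) → Cycle G c (mkPath a (x ∷ xs))
  CycleAt⇒Cycle {a} {x} {xs} cyc = walk , (distinct-edges , repeats-only-at-ends) , sym closed , λ ()
    where
    open CycleAt cyc
    repeats-only-at-ends : ∀ i j → i <ᶠ j → lookup (a ∷ targets (x ∷ xs)) i ≡ lookup (a ∷ targets (x ∷ xs)) j →
                           toℕ i ≡ 0 × suc (toℕ j) ≡ length (a ∷ targets (x ∷ xs))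
    repeats-only-at-ends zero    (suc j) _         same =
      refl , cong (λ n → ℕ.suc (ℕ.suc n)) (trans (cong toℕ j-last) (toℕ-fromℕ _))
      where
      j-last : j ≡ fromℕ (length (targets xs))
      j-last = lookup-injective distinct-vertices (trans (sym same) (trans (sym closed)
                 (sym (lookup-last a (x ∷ xs) (cong suc (cong suc (toℕ-fromℕ _)))))))
    repeats-only-at-ends (suc i) (suc j) (s≤s i<j) same =
      ⊥-elim (<-irrefl (cong toℕ (lookup-injective distinct-vertices same)) i<j)

  NoInnerCusp⇒ : ∀ xs → NoInnerCusp xs → ∀ {e w f} → (e , w , f) ∈ innerTurns G c xs → ¬ Cusp e w f
  NoInnerCusp⇒ ((e , w) ∷ (f , x) ∷ xs) (j , _)  (here refl) = j
  NoInnerCusp⇒ ((e , w) ∷ (f , x) ∷ xs) (_ , nc) (there t∈)  = NoInnerCusp⇒ ((f , x) ∷ xs) nc t∈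

  ⇒NoInnerCusp : ∀ xs → (∀ {e w f} → (e , w , f) ∈ innerTurns G c xs → ¬ Cusp e w f) → NoInnerCusp xs
  ⇒NoInnerCusp []                        _  = _
  ⇒NoInnerCusp (_ ∷ [])                  _  = _
  ⇒NoInnerCusp ((e , w) ∷ (f , x) ∷ xs) nc = nc (here refl) , ⇒NoInnerCusp ((f , x) ∷ xs) (nc ∘ there)

  join∈innerTurns : ∀ x xs y ys →
                    (lastEdge x xs , proj₂ (lastStep G c x xs) , proj₁ y) ∈ innerTurns G c ((x ∷ xs) ++ (y ∷ ys))
  join∈innerTurns x []       y ys = here refl
  join∈innerTurns x (z ∷ xs) y ys = there (join∈innerTurns z xs y ys)

  closingTurn⁻ : ∀ a x xs {t} → t ∈ closingTurn G c a (x ∷ xs) →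
                 end a (x ∷ xs) ≡ a × t ≡ (lastEdge x xs , a , proj₁ x)
  closingTurn⁻ a x xs t∈ with proj₂ (lastStep G c x xs) ≟ a
  closingTurn⁻ a x xs (here refl) | yes closed = closed , refl

  closingTurn⁺ : ∀ a x xs → end a (x ∷ xs) ≡ a → (lastEdge x xs , a , proj₁ x) ∈ closingTurn G c a (x ∷ xs)
  closingTurn⁺ a x xs closed with proj₂ (lastStep G c x xs) ≟ a
  ... | yes _    = here refl
  ... | no  open′ = ⊥-elim (open′ closed)

  CuspFree⇒NoInnerCusp : ∀ {a xs} → CuspFree G c (mkPath a xs) → NoInnerCusp xs
  CuspFree⇒NoInnerCusp {xs = xs} cf = ⇒NoInnerCusp xs (λ t∈ cusp → cf _ _ _ (∈-++⁺ˡ t∈ , cusp))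

  CuspFree-open : ∀ {a xs} → end a xs ≢ a → NoInnerCusp xs → CuspFree G c (mkPath a xs)
  CuspFree-open {a} {xs} open′ nc e w f (t∈ , cusp) with ∈-++⁻ (innerTurns G c xs) t∈
  ... | inj₁ inner = NoInnerCusp⇒ xs nc inner cusp
  CuspFree-open {a} {x ∷ xs} open′ nc e w f (t∈ , cusp) | inj₂ closing =
    open′ (proj₁ (closingTurn⁻ a x xs closing))

  CuspFree-closed : ∀ {a x xs} → NoInnerCusp (x ∷ xs) → ¬ Cusp (lastEdge x xs) a (proj₁ x) →
                    CuspFree G c (mkPath a (x ∷ xs))
  CuspFree-closed {a} {x} {xs} nc smooth-at-a e w f (t∈ , cusp) with ∈-++⁻ (innerTurns G c (x ∷ xs)) t∈
  ... | inj₁ inner   = NoInnerCusp⇒ (x ∷ xs) nc inner cusp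
  ... | inj₂ closing with closingTurn⁻ a x xs closing
  ...   | _ , refl = smooth-at-a cusp

  -- The content of (a , α) →ₚ (end a xs , _) for p = mkPath a xs, see Route⇒Arrow and Arrow⇒Route.
  record Route (a : Vertex) (α : Fin k) (xs : List Step) : Set where
    field
      simple  : SimpleWalk a xs
      smooth  : NoInnerCusp xs
      departs : OnFirstEdge (λ e → c e a ≢ α) xs

  Route-prefix : ∀ {a α} xs z ys → Route a α (xs ++ z ∷ ys) → Route a α (xs ++ [ z ])
  Route-prefix {a} {α} xs z ys r = record
    { simple  = SimpleWalk-++⁻ˡ (xs ++ [ z ]) (subst (SimpleWalk _) (sym (++-assoc xs [ z ] ys)) simple)
    ; smooth  = proj₁ (NoInnerCusp-++⁻ (xs ++ [ z ]) (subst NoInnerCusp (sym (++-assoc xs [ z ] ys)) smooth))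
    ; departs = departs′ xs departs
    }
    where
    open Route r
    departs′ : ∀ xs → OnFirstEdge (λ e → c e a ≢ α) (xs ++ z ∷ ys) → OnFirstEdge (λ e → c e a ≢ α) (xs ++ [ z ])
    departs′ []      d = d
    departs′ (_ ∷ _) d = d

  Route⇒Arrow : ∀ {a α x xs} → Route a α (x ∷ xs) →
                Arrow G c a α (mkPath a (x ∷ xs)) (end a (x ∷ xs)) (c (lastEdge x xs) (end a (x ∷ xs)))
  Route⇒Arrow r = walk , SimpleWalk⇒Simple simple , SimpleWalk-open simple ,
                  CuspFree-open (SimpleWalk-open simple ∘ sym) smooth , refl , refl , departs , refl
    where
    open Route r
    open SimpleWalk simple using (walk)

  Arrow-start : ∀ {a α p y τ} → Arrow G c a α p y τ → start p ≡ a
  Arrow-start {p = mkPath _ (_ ∷ _)} (_ , _ , _ , _ , starts , _) = starts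

  Arrow⇒Route : ∀ {a α xs y τ} → Arrow G c a α (mkPath a xs) y τ → Route a α xs × end a xs ≡ y
  Arrow⇒Route {xs = _ ∷ _} (ok , simple , open′ , cf , _ , ends , departs , _) =
    record { simple  = Simple⇒SimpleWalk ok simple open′
           ; smooth  = CuspFree⇒NoInnerCusp cf
           ; departs = departs
           } , ends

module Decision (G : PartialGraph) {k : ℕ} (c : Coloring G k) where

  open Walk G c
  open Membership (≡-dec (_≟_ {nE G}) (≡-dec (_≟_ {nV G}) (_≟_ {nE G}))) using () renaming (_∈?_ to _∈ᵗ?_)
  open Membership (_≟_ {nV G}) using () renaming (_∈?_ to _∈ᵛ?_)

  cuspAt? : ∀ w p → Dec (CuspAt G c w p)
  cuspAt? w p = any? λ e → any? λ f → ((e , w , f) ∈ᵗ? turns G c p) ×-dec cusp? e w f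

  Arrow-length : ∀ {a α a₀ xs y τ} → Arrow G c a α (mkPath a₀ xs) y τ → length xs ≤ nV G
  Arrow-length {a₀ = a₀} {xs} arrow with Arrow-start arrow
  ... | refl = ≤-trans (n≤1+n _) (subst (_≤ nV G) (cong suc (length-map proj₂ xs))
                 (Unique-length≤ (SimpleWalk.distinct-vertices (Route.simple (proj₁ (Arrow⇒Route arrow))))))

  ∃-step? : {Q : Step → Set} → (∀ s → Dec (Q s)) → Dec (∃ Q)
  ∃-step? Q? = map′ (λ (e , w , q) → (e , w) , q) (λ ((e , w) , q) → e , w , q) (any? λ e → any? λ w → Q? (e , w))

  ∃-steps≤? : ∀ n {P : List Step → Set} → (∀ xs → Dec (P xs)) → Dec (∃ λ xs → length xs ≤ n × P xs)
  ∃-steps≤? zero    P? = map′ (λ p → [] , z≤n , p) (λ { ([] , _ , p) → p }) (P? [])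
  ∃-steps≤? (suc n) {P} P? = map′ to from (P? [] ⊎-dec ∃-step? λ s → ∃-steps≤? n (P? ∘ (s ∷_)))
    where
    to : P [] ⊎ ∃ (λ s → ∃ λ xs → length xs ≤ n × P (s ∷ xs)) → ∃ λ xs → length xs ≤ suc n × P xs
    to (inj₁ p)                  = [] , z≤n , p
    to (inj₂ (s , xs , |xs| , p)) = s ∷ xs , s≤s |xs| , p
    from : (∃ λ xs → length xs ≤ suc n × P xs) → P [] ⊎ ∃ (λ s → ∃ λ xs → length xs ≤ n × P (s ∷ xs))
    from ([]     , _       , p) = inj₁ p
    from (s ∷ xs , s≤s |xs| , p) = inj₂ (s , xs , |xs| , p)

  IsWalk? : ∀ a xs → Dec (IsWalk a xs)
  IsWalk? a []             = yes _
  IsWalk? a ((e , w) ∷ xs) =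
    ¬? (a ≟ w) ×-dec all? (λ x → (x ∈ˢ? ends G e) ⇔-dec ((x ≟ a) ⊎-dec (x ≟ w))) ×-dec IsWalk? w xs

  Simple? : ∀ p → Dec (Simple G c p)
  Simple? p = unique? (edges G c p) ×-dec all? λ i → all? λ j →
    (i <ᶠ? j) →-dec (lookup L i ≟ lookup L j) →-dec ((toℕ i ℕ.≟ 0) ×-dec (suc (toℕ j) ℕ.≟ length L))
    where
    L : List Vertex
    L = vertices G c p
    open import Data.List.Relation.Unary.Unique.DecPropositional (_≟_ {nE G}) using (unique?)

  CuspFree? : ∀ p → Dec (CuspFree G c p)
  CuspFree? p = all? λ e → all? λ w → all? λ f → ¬? (((e , w , f) ∈ᵗ? turns G c p) ×-dec cusp? e w f)

  Arrow? : ∀ a α p b β → Dec (Arrow G c a α p b β)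
  Arrow? a α (mkPath a₀ [])       b β = no λ ()
  Arrow? a α (mkPath a₀ (x ∷ xs)) b β =
    IsWalk? a₀ (x ∷ xs) ×-dec Simple? (mkPath a₀ (x ∷ xs)) ×-dec ¬? (a₀ ≟ end a₀ (x ∷ xs)) ×-dec
    CuspFree? (mkPath a₀ (x ∷ xs)) ×-dec (a₀ ≟ a) ×-dec (end a₀ (x ∷ xs) ≟ b) ×-dec
    ¬? (c (proj₁ x) a₀ ≟ α) ×-dec (c (lastEdge x xs) (end a₀ (x ∷ xs)) ≟ β)

  -- Bounded search suffices since arrows have at most nV G steps (Arrow-length).
  Lhd? : ∀ a α b β → Dec (Lhd G c a α b β)
  Lhd? a α b β = map′ to from (∃-steps≤? (nV G) λ ps → Arrow? a α (mkPath a ps) b β ×-dec ¬? (returns? ps))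
    where
    Returns : List Step → Set
    Returns ps = ∃ λ qs → length qs ≤ nV G × ∃ λ x → ∃ λ τ → Arrow G c b β (mkPath b qs) x τ × x ∈ a ∷ targets ps
    returns? : ∀ ps → Dec (Returns ps)
    returns? ps = ∃-steps≤? (nV G) λ qs → any? λ x → any? λ τ →
      Arrow? b β (mkPath b qs) x τ ×-dec (x ∈ᵛ? a ∷ targets ps)
    to : (∃ λ ps → length ps ≤ nV G × Arrow G c a α (mkPath a ps) b β × ¬ Returns ps) → Lhd G c a α b β
    to (ps , _ , arrow , no-return) = mkPath a ps , arrow , λ x τ q arrow′ x∈ →
      no-return (steps q , Arrow-length arrow′ , x , τ ,
                 subst (λ z → Arrow G c b β (mkPath z (steps q)) x τ) (Arrow-start arrow′) arrow′ , x∈)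
    from : Lhd G c a α b β → ∃ λ ps → length ps ≤ nV G × Arrow G c a α (mkPath a ps) b β × ¬ Returns ps
    from (p , arrow , no-return) = steps p , Arrow-length arrow ,
      subst (λ z → Arrow G c a α (mkPath z (steps p)) b β) (Arrow-start arrow) arrow ,
      λ (qs , _ , x , τ , arrow′ , x∈) →
        no-return x τ (mkPath b qs) arrow′ (subst (λ z → x ∈ z ∷ targets (steps p)) (sym (Arrow-start arrow)) x∈)

  target? : ∀ v α → Dec (∃[ u ] ∃[ β ] (CuspPoint G c u β × Lhd G c v α u β))
  target? v α = any? λ u → any? λ β → (any? λ e → any? λ f → cusp? e u f ×-dec (c e u ≟ β)) ×-dec Lhd? v α u β

module Rerouting (G : PartialGraph) {k : ℕ} (c : Coloring G k)
                 (no-cusp-free-cycle : NoCuspFreeCycle G c) (v : Fin (nV G)) (α : Fin k)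
                 (no-target : ¬ (∃[ u ] ∃[ β ] (CuspPoint G c u β × Lhd G c v α u β))) where

  open Walk G c
  open Decision G c
  open Membership (_≟_ {nV G}) using (_∈?_)

  -- A cycle through v, scanned from v up to the end of ps; ss is still to be scanned.
  record Scan (ps ss : List Step) : Set where
    field
      cycle       : CycleAt v (ps ++ ss)
      smooth      : NoInnerCusp ps
      departs     : OnFirstEdge (λ e → c e v ≢ α) ps
      smooth-at-v : NoCuspAtJoin ss ps
      unfinished  : ss ≢ []

  Shorter : List Step → Set
  Shorter ss = ∀ {ps′ ss′} → length ss′ < length ss → Scan ps′ ss′ → ⊥

  advance : ∀ ps s ss → Scan ps (s ∷ ss) → NoCuspAtJoin ps (s ∷ ss) → Shorter (s ∷ ss) → ⊥
  advance []       s ss       sc _      _  = Scan.departs sc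
  advance (p ∷ ps) s []       sc smooth _  =
    no-cusp-free-cycle (mkPath v ((p ∷ ps) ++ [ s ])) (CycleAt⇒Cycle cycle)
      (CuspFree-closed (NoInnerCusp-++⁺ (p ∷ ps) (Scan.smooth sc) smooth _) smooth-at-v′)
    where
    open Scan sc using (cycle; smooth-at-v)
    smooth-at-v′ : ¬ Cusp (lastEdge p (ps ++ [ s ])) v (proj₁ p)
    smooth-at-v′ = subst₂ (λ e w → ¬ Cusp e w (proj₁ p)) (cong proj₁ (sym last≡s))
                     (trans (cong proj₂ (sym last≡s)) (CycleAt.closed cycle)) smooth-at-v
      where
      last≡s : lastStep G c p (ps ++ [ s ]) ≡ s
      last≡s = lastStep-++ p ps s []
  advance (p ∷ ps) s (s′ ∷ ss) sc smooth IH = IH ≤-refl record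
    { cycle       = subst (CycleAt v) (sym (++-assoc (p ∷ ps) [ s ] (s′ ∷ ss))) cycle
    ; smooth      = NoInnerCusp-++⁺ (p ∷ ps) smooth′ smooth _
    ; departs     = departs
    ; smooth-at-v = smooth-at-v
    ; unfinished  = λ ()
    }
    where open Scan sc renaming (smooth to smooth′)

  Scan⇒Route : ∀ {p P s S} → Scan (p ∷ P) (s ∷ S) → Route v α (p ∷ P)
  Scan⇒Route {p} {P} {s} {S} sc = record
    { simple = CycleAt-prefix (p ∷ P) s S cycle ; smooth = smooth ; departs = departs }
    where open Scan sc

  module AtCusp {p P s S} (sc : Scan (p ∷ P) (s ∷ S)) (IH : Shorter (s ∷ S))
                (cusp : Cusp (lastEdge p P) (end v (p ∷ P)) (proj₁ s)) where

    open Scan sc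

    u : Vertex
    u = end v (p ∷ P)

    β : Fin k
    β = c (lastEdge p P) u

    s-colour : c (proj₁ s) u ≡ β
    s-colour = sym (cusp-colour cusp)

    S-returns : end u (s ∷ S) ≡ v
    S-returns = trans (sym (end-++ v (p ∷ P) (s ∷ S))) (CycleAt.closed cycle)

    OnCycle : Vertex → Set
    OnCycle z = z ∈ v ∷ targets ((p ∷ P) ++ (s ∷ S))

    record Detour (qa : List Step) (g : Edge) (y : Vertex) : Set where
      field
        route     : Route u β (qa ++ [ (g , y) ])
        off-cycle : All (¬_ ∘ OnCycle) (targets qa)
        lands     : OnCycle y

    module _ {qa g y} (d : Detour qa g y) where

      open Detour d
      open Route route renaming (smooth to Q-smooth; departs to Q-departs)

      Q : List Step
      Q = qa ++ [ (g , y) ]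

      Q-ends : end u Q ≡ y
      Q-ends = end-++ u qa [ (g , y) ]

      u∉Q : u ∉ targets Q
      u∉Q = Uniqueₚ.Unique[x∷xs]⇒x∉xs (SimpleWalk.distinct-vertices simple)

      y≢u : y ≢ u
      y≢u y≡u = u∉Q (subst (_∈ targets Q) y≡u y∈Q)
        where
        y∈Q : y ∈ targets Q
        y∈Q = subst (y ∈_) (sym (map-++ proj₂ qa [ (g , y) ])) (∈-++⁺ʳ (targets qa) (here refl))

      meets-cycle-only-at-end : ∀ {z} → z ∈ targets Q → OnCycle z → z ≡ y
      meets-cycle-only-at-end z∈Q on-cycle with ∈-++⁻ (targets qa) (subst (_ ∈_) (map-++ proj₂ qa [ (g , y) ]) z∈Q)
      ... | inj₁ z∈qa        = ⊥-elim (All.lookup off-cycle z∈qa on-cycle)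
      ... | inj₂ (here z≡y) = z≡y

      leaves-in-new-colour : ∀ {e} → e ∈ edgesOf Q → u ∈ˢ ends G e → c e u ≢ β
      leaves-in-new-colour e∈Q u∈e = OnFirstEdge-≡ Q (edge-at-start (SimpleWalk.walk simple) u∉Q e∈Q u∈e) Q-departs

      fresh-edges : Disjoint (edgesOf Q) (edgesOf ((p ∷ P) ++ (s ∷ S)))
      fresh-edges (e∈Q , e∈C) with edge-source-snoc qa (SimpleWalk.walk simple) e∈Q
      ... | x , x∈e , there x∈qa = All.lookup off-cycle x∈qa (edge-endpoint∈ (CycleAt.walk cycle) e∈C x∈e)
      ... | x , x∈e , here refl with CycleAt-junction p P s S cycle e∈C x∈e
      ...   | inj₁ refl = leaves-in-new-colour e∈Q x∈e refl
      ...   | inj₂ refl = leaves-in-new-colour e∈Q x∈e s-colour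

      departs-smoothly : OnFirstEdge (SmoothInto (p ∷ P)) Q
      departs-smoothly = OnFirstEdge-map Q (λ new-colour cusp′ → new-colour (sym (cusp-colour cusp′))) Q-departs

      -- The detour lands on ss: it replaces the stretch a ∷ A of ss.
      module Ahead (a : Step) (A : List Step) (b : Step) (B : List Step)
                   (split : s ∷ S ≡ (a ∷ A) ++ (b ∷ B)) (at-y : end u (a ∷ A) ≡ y) where

        cycle′ : CycleAt v ((p ∷ P) ++ Q ++ (b ∷ B))
        cycle′ = CycleAt-splice (p ∷ P) a A (b ∷ B) (subst (λ S′ → CycleAt v ((p ∷ P) ++ S′)) split cycle)
                   simple (trans Q-ends (sym at-y)) meets
                   (λ {e} (e∈Q , e∈C) → fresh-edges (e∈Q , subst (λ S′ → e ∈ edgesOf ((p ∷ P) ++ S′)) (sym split) e∈C))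
          where
          meets : ∀ {z} → z ∈ targets Q → z ∈ targets ((p ∷ P) ++ (a ∷ A) ++ (b ∷ B)) → z ≡ end u (a ∷ A)
          meets {z} z∈Q z∈C = trans (meets-cycle-only-at-end z∈Q
            (there (subst (λ S′ → z ∈ targets ((p ∷ P) ++ S′)) (sym split) z∈C))) (sym at-y)

        scan′ : Scan ((p ∷ P) ++ Q) (b ∷ B)
        scan′ = record
          { cycle       = subst (CycleAt v) (sym (++-assoc (p ∷ P) Q (b ∷ B))) cycle′
          ; smooth      = NoInnerCusp-++⁺ (p ∷ P) smooth (NoCuspAtJoin-into (p ∷ P) Q departs-smoothly) Q-smooth
          ; departs     = departs
          ; smooth-at-v = subst id (SmoothInto-++ˡ (a ∷ A) b B (proj₁ p))
                            (subst (λ S′ → SmoothInto S′ (proj₁ p)) split smooth-at-v)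
          ; unfinished  = λ ()
          }

        shorter : length (b ∷ B) < length (s ∷ S)
        shorter = subst (λ S′ → length (b ∷ B) < length S′) (sym split)
                    (s≤s (subst (length (b ∷ B) ≤_) (sym (length-++ A)) (m≤n+m _ (length A))))

        impossible : ⊥
        impossible = IH shorter scan′

      -- The detour lands on ps: the cycle b ∷ PB followed by Q can only have its cusp at y, so ps
      -- may as well continue from y along Q reversed, which arrives at u without a cusp with s.
      module Behind (PA : List Step) (b : Step) (PB : List Step)
                    (split : p ∷ P ≡ PA ++ b ∷ PB) (at-y : end v PA ≡ y) where

        cycle-steps : (p ∷ P) ++ (s ∷ S) ≡ PA ++ (b ∷ PB) ++ (s ∷ S)
        cycle-steps = trans (cong (_++ (s ∷ S)) split) (++-assoc PA (b ∷ PB) (s ∷ S))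

        PB⊆cycle : (b ∷ PB) ⊆ (p ∷ P) ++ (s ∷ S)
        PB⊆cycle = subst ((b ∷ PB) ⊆_) (sym cycle-steps) (⊆-trans (xs⊆xs++ys (b ∷ PB) (s ∷ S)) (xs⊆ys++xs _ PA))

        b-elsewhere : proj₁ b ∉ edgesOf PA ++ edgesOf (s ∷ S)
        b-elsewhere b∈ = Unique-middle-disjoint (edgesOf PA) (edgesOf (b ∷ PB))
          (subst Unique (map-++-++ proj₁ PA (b ∷ PB) (s ∷ S))
            (subst (Unique ∘ edgesOf) cycle-steps (CycleAt.distinct-edges cycle)))
          (here refl , b∈)

        P-parts : NoInnerCusp PA × NoCuspAtJoin PA (b ∷ PB) × NoInnerCusp (b ∷ PB)
        P-parts = NoInnerCusp-++⁻ PA (subst NoInnerCusp split smooth)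

        PB-last : lastStep G c b PB ≡ lastStep G c p P
        PB-last = sym (lastStep-split p P PA b PB split)

        PB-returns : end y (b ∷ PB) ≡ u
        PB-returns = begin
          end (end v PA) (b ∷ PB)  ≡⟨ end-++ v PA (b ∷ PB) ⟨
          end v (PA ++ b ∷ PB)     ≡⟨ cong (end v) split ⟨
          u                        ∎

        cycle-D : CycleAt y ((b ∷ PB) ++ Q)
        cycle-D = CycleAt-append (b ∷ PB) PB-simple (subst (λ w → SimpleWalk w Q) (sym PB-returns) simple)
                    (trans (cong (λ w → end w Q) PB-returns) Q-ends) meets
                    (λ (e∈Q , e∈PB) → fresh-edges (e∈Q , map⁺ proj₁ PB⊆cycle e∈PB))
          where
          PB-simple : SimpleWalk y (b ∷ PB)
          PB-simple = subst (λ w → SimpleWalk w (b ∷ PB)) at-y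
                        (SimpleWalk-++⁻ʳ PA (subst (SimpleWalk v) split (Route.simple (Scan⇒Route sc))))
          meets : ∀ {z} → z ∈ targets Q → z ∈ y ∷ targets (b ∷ PB) → z ≡ y
          meets z∈Q (here z≡y)   = z≡y
          meets z∈Q (there z∈PB) = meets-cycle-only-at-end z∈Q (there (map⁺ proj₂ PB⊆cycle z∈PB))

        cusp-at-y : Cusp g y (proj₁ b)
        cusp-at-y with cusp? g y (proj₁ b)
        ... | yes cusp′       = cusp′
        ... | no smooth-at-y = ⊥-elim (no-cusp-free-cycle (mkPath y ((b ∷ PB) ++ Q)) (CycleAt⇒Cycle cycle-D)
                                 (CuspFree-closed D-smooth closing))
          where
          D-smooth : NoInnerCusp ((b ∷ PB) ++ Q)
          D-smooth = NoInnerCusp-++⁺ (b ∷ PB) (proj₂ (proj₂ P-parts))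
                       (NoCuspAtJoin-into (b ∷ PB) Q
                         (subst (λ t → OnFirstEdge (¬_ ∘ Cusp (proj₁ t) (proj₂ t)) Q) (sym PB-last) departs-smoothly))
                       Q-smooth
          closing : ¬ Cusp (lastEdge b (PB ++ Q)) y (proj₁ b)
          closing = subst (λ e → ¬ Cusp e y (proj₁ b))
                      (cong proj₁ (sym (trans (cong (lastStep G c b) (sym (++-assoc PB qa [ (g , y) ])))
                                              (lastStep-++ b (PB ++ qa) (g , y) []))))
                      smooth-at-y

        R : List Step
        R = (g , end u qa) ∷ reverseWalk u qa

        R-form : reverseWalk u Q ≡ R
        R-form = reverseWalk-snoc u qa g y

        R-simple : SimpleWalk y R
        R-simple = subst₂ SimpleWalk Q-ends R-form (SimpleWalk-reverse simple)

        R-returns : end y R ≡ u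
        R-returns = subst₂ (λ w R′ → end w R′ ≡ u) Q-ends R-form (end-reverseWalk u Q)

        R-targets : ∀ {z} → z ∈ targets R → z ∈ u ∷ targets qa
        R-targets (here refl)  = end∈vertices u qa
        R-targets (there z∈qa) = targets-reverseWalk⊆ u qa z∈qa

        cycle′ : CycleAt v (PA ++ R ++ (s ∷ S))
        cycle′ = CycleAt-splice PA b PB (s ∷ S) (subst (CycleAt v) cycle-steps cycle)
                   (subst (λ w → SimpleWalk w R) (sym at-y) R-simple) same-end meets fresh
          where
          same-end : end (end v PA) R ≡ end (end v PA) (b ∷ PB)
          same-end = trans R-returns (sym PB-returns)
          meets : ∀ {z} → z ∈ targets R → z ∈ targets (PA ++ (b ∷ PB) ++ (s ∷ S)) → z ≡ end (end v PA) (b ∷ PB)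
          meets {z} z∈R z∈C with R-targets z∈R
          ... | here refl  = sym PB-returns
          ... | there z∈qa =
            ⊥-elim (All.lookup off-cycle z∈qa (there (subst (λ C → z ∈ targets C) (sym cycle-steps) z∈C)))
          fresh : Disjoint (edgesOf R) (edgesOf (PA ++ (b ∷ PB) ++ (s ∷ S)))
          fresh {e} (e∈R , e∈C) = fresh-edges
            ( Anyₚ.reverse⁻ (subst (e ∈_) (trans (cong edgesOf (sym R-form)) (edgesOf-reverseWalk u Q)) e∈R)
            , subst (λ C → e ∈ edgesOf C) (sym cycle-steps) e∈C )

        g≈b : Cusp g (end v PA) (proj₁ b)
        g≈b = subst (λ w → Cusp g w (proj₁ b)) (sym at-y) cusp-at-y

        when-PA-empty : PA ≡ [] → Cusp g v (proj₁ b)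
        when-PA-empty PA≡[] = subst (λ A → Cusp g (end v A) (proj₁ b)) PA≡[] g≈b

        scan′ : Scan (PA ++ R) (s ∷ S)
        scan′ = record
          { cycle       = subst (CycleAt v) (sym (++-assoc PA R (s ∷ S))) cycle′
          ; smooth      = NoInnerCusp-++⁺ PA (proj₁ P-parts)
                            (SmoothInto-replace v PA g≈b (b-elsewhere ∘ ∈-++⁺ˡ) (proj₁ (proj₂ P-parts)))
                            (subst NoInnerCusp R-form (NoInnerCusp-reverse u Q Q-smooth))
          ; departs     = OnFirstEdge-++-swap PA (subst (OnFirstEdge _) split departs) λ PA≡[] b-departs g-colour →
                            b-departs (trans (sym (cusp-colour (when-PA-empty PA≡[]))) g-colour)
          ; smooth-at-v = NoCuspAtJoin-into (s ∷ S) (PA ++ R)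
                            (OnFirstEdge-++-swap PA (subst (OnFirstEdge (SmoothInto (s ∷ S))) split smooth-at-v) λ PA≡[] →
                              SmoothInto-replace u (s ∷ S)
                                (subst (λ w → Cusp g w (proj₁ b)) (sym S-returns) (when-PA-empty PA≡[]))
                                (b-elsewhere ∘ ∈-++⁺ʳ (edgesOf PA)))
          ; unfinished  = λ ()
          }

        into-s : NoCuspAtJoin (PA ++ R) (s ∷ S)
        into-s = subst id (sym (SmoothInto-++ˡ PA (g , end u qa) (reverseWalk u qa) (proj₁ s)))
                   (subst (λ R′ → SmoothInto R′ (proj₁ s)) R-form (SmoothInto-reverse u Q
                     (OnFirstEdge-map Q (λ new-colour cusp′ → new-colour (trans (cusp-colour cusp′) s-colour)) Q-departs)))

        impossible : ⊥
        impossible = advance (PA ++ R) s S scan′ into-s IH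

      behind : y ∈ v ∷ targets (p ∷ P) → ⊥
      behind y∈ with split-at-vertex v (p ∷ P) y∈
      ... | PA , []     , split , at-y = y≢u (trans (sym at-y) (cong (end v) (sym (trans split (++-identityʳ PA)))))
      ... | PA , b ∷ PB , split , at-y = Behind.impossible PA b PB split at-y

      ahead : y ∈ targets (s ∷ S) → y ≢ v → ⊥
      ahead y∈ y≢v with split-at-vertex u (s ∷ S) (there y∈)
      ... | []    , _     , _     , at-y = y≢u (sym at-y)
      ... | a ∷ A , []    , split , at-y =
        y≢v (trans (sym at-y) (trans (cong (end u) (sym (trans split (++-identityʳ _)))) S-returns))
      ... | a ∷ A , b ∷ B , split , at-y = Ahead.impossible a A b B split at-y

      detour-impossible : ⊥
      detour-impossible with lands
      ... | here y≡v  = behind (here y≡v)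
      ... | there y∈C with ∈-++⁻ (targets (p ∷ P)) (subst (y ∈_) (map-++ proj₂ (p ∷ P) (s ∷ S)) y∈C)
      ...   | inj₁ y∈P = behind (there y∈P)
      ...   | inj₂ y∈S with y ≟ v
      ...     | yes y≡v = behind (here y≡v)
      ...     | no  y≢v = ahead y∈S y≢v

    on-cycle : ∀ {z} → z ∈ v ∷ targets (p ∷ P) → OnCycle z
    on-cycle (here z≡v)  = here z≡v
    on-cycle (there z∈P) = there (map⁺ proj₂ (xs⊆xs++ys (p ∷ P) (s ∷ S)) z∈P)

    reaches-cycle : ∀ {qs} → Route u β qs → end u qs ∈ v ∷ targets (p ∷ P) → Any (OnCycle ∘ proj₂) qs
    reaches-cycle {[]}     route _     = ⊥-elim (Route.departs route)
    reaches-cycle {q ∷ qs} _     end∈P =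
      Anyₚ.map⁻ (Any.map (λ end≡z → subst OnCycle end≡z (on-cycle end∈P)) (end∈targets u q qs))

    no-detour : ∀ qs → Route u β qs → end u qs ∈ v ∷ targets (p ∷ P) → ⊥
    no-detour qs route end∈P
      with first-visit (λ t → proj₂ t ∈? v ∷ targets ((p ∷ P) ++ (s ∷ S))) (reaches-cycle route end∈P)
    ... | First._++_∷_ {qa} {g , y} off-cycle lands qb = detour-impossible (record
      { route = Route-prefix qa (g , y) qb route ; off-cycle = Allₚ.map⁺ off-cycle ; lands = lands })

    no-return : ∀ x τ q → Arrow G c u β q x τ → x ∉ vertices G c (mkPath v (p ∷ P))
    no-return x τ (mkPath q₀ qs) arrow x∈P with Arrow-start arrow
    ... | refl with Arrow⇒Route arrow
    ...   | route , refl = no-detour qs route x∈P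

    impossible : ⊥
    impossible = no-target (u , β , (lastEdge p P , proj₁ s , cusp , refl) , mkPath v (p ∷ P) ,
                            Route⇒Arrow (Scan⇒Route sc) , no-return)

  scan-impossible : ∀ ps ss → Scan ps ss → ⊥
  scan-impossible ps ss = go ps ss (<-wellFounded (length ss))
    where
    go : ∀ ps ss → Acc _<_ (length ss) → Scan ps ss → ⊥
    go []       _        _         sc = Scan.departs sc
    go (_ ∷ _)  []       _         sc = Scan.unfinished sc refl
    go (p ∷ ps) (s ∷ ss) (acc rec) sc = by-junction (cusp? (lastEdge p ps) (end v (p ∷ ps)) (proj₁ s))
      where
      IH : Shorter (s ∷ ss)
      IH lt = go _ _ (rec lt)
      by-junction : Dec (Cusp (lastEdge p ps) (end v (p ∷ ps)) (proj₁ s)) → ⊥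
      by-junction (yes cusp)   = AtCusp.impossible sc IH cusp
      by-junction (no  smooth) = advance (p ∷ ps) s ss sc smooth IH

  scan-from : ∀ L → CycleAt v L → NoCuspAtJoin L L → OnFirstEdge (λ e → c e v ≢ α) L → ⊥
  scan-from []           _   _      departs = departs
  scan-from (x ∷ [])     cyc _      _       = proj₁ (CycleAt.walk cyc) (sym (CycleAt.closed cyc))
  scan-from (x ∷ y ∷ ys) cyc smooth departs = scan-impossible [ x ] (y ∷ ys) (record
    { cycle = cyc ; smooth = _ ; departs = departs ; smooth-at-v = smooth ; unfinished = λ () })

  -- Without a cusp at v, the first and the last edge of L cannot both have colour α at v.
  smooth-cycle-impossible : ∀ L → CycleAt v L → L ≢ [] → NoCuspAtJoin L L → ⊥
  smooth-cycle-impossible []       _   nonempty _      = nonempty refl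
  smooth-cycle-impossible (x ∷ xs) cyc _        smooth with c (proj₁ x) v ≟ α
  ... | no  x-departs = scan-from (x ∷ xs) cyc smooth x-departs
  ... | yes x-colour  = scan-from R (CycleAt-reverse cyc)
                          (NoCuspAtJoin-into R R (OnFirstEdge-map R R-smooth (reverseWalk-first v x xs)))
                          (OnFirstEdge-map R (λ { refl → ℓ-departs }) (reverseWalk-first v x xs))
    where
    open CycleAt cyc
    R : List Step
    R = reverseWalk v (x ∷ xs)
    ℓ : Edge
    ℓ = lastEdge x xs
    ℓ-departs : c ℓ v ≢ α
    ℓ-departs ℓ-colour = smooth
      ( CycleAt-last≢first x xs cyc
      , end∈ends x xs walk
      , subst (_∈ˢ ends G (proj₁ x)) (sym closed) (start∈ends walk)
      , subst (λ w → c ℓ w ≡ c (proj₁ x) w) (sym closed) (trans ℓ-colour (sym x-colour)) )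
    R-smooth : ∀ {e} → ℓ ≡ e → SmoothInto R e
    R-smooth refl = subst id (sym (SmoothInto-++ˡ (reverseWalk (proj₂ x) xs) (proj₁ x , v) [] ℓ))
                      (λ cusp → smooth (subst (λ w → Cusp ℓ w (proj₁ x)) (sym closed) (cusp-sym cusp)))

  Rooted : List Step → Set
  Rooted L = CycleAt v L × L ≢ [] × NoCuspAtJoin L L

  rooted-at-start : ∀ {v₀} x xs → v₀ ≡ v → Cycle G c (mkPath v₀ (x ∷ xs)) → ¬ CuspAt G c v (mkPath v₀ (x ∷ xs)) →
                    Rooted (x ∷ xs)
  rooted-at-start x xs refl cyc no-cusp = cyc′ , (λ ()) , λ cusp →
    no-cusp (lastEdge x xs , proj₁ x , ∈-++⁺ʳ (innerTurns G c (x ∷ xs)) (closingTurn⁺ v x xs closed) ,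
             subst (λ w → Cusp (lastEdge x xs) w (proj₁ x)) closed cusp)
    where
    cyc′ : CycleAt v (x ∷ xs)
    cyc′ = Cycle⇒CycleAt cyc
    open CycleAt cyc′ using (closed)

  rooted : ∀ v₀ cs → Cycle G c (mkPath v₀ cs) → v ∈ v₀ ∷ targets cs → ¬ CuspAt G c v (mkPath v₀ cs) → ∃ Rooted
  rooted v₀ []       (_ , _ , _ , nonempty) _  _       = ⊥-elim (nonempty refl)
  rooted v₀ (x ∷ xs) cyc                    v∈ no-cusp = by-split (split-at-vertex v₀ (x ∷ xs) v∈)
    where
    by-split : (∃₂ λ A B → x ∷ xs ≡ A ++ B × end v₀ A ≡ v) → ∃ Rooted
    by-split ([]    , _     , _     , v₀≡v) = x ∷ xs , rooted-at-start x xs v₀≡v cyc no-cusp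
    by-split (a ∷ A , []    , split , at-v) = x ∷ xs , rooted-at-start x xs v₀≡v cyc no-cusp
      where
      v₀≡v : v₀ ≡ v
      v₀≡v = trans (sym (CycleAt.closed (Cycle⇒CycleAt cyc)))
                   (trans (cong (end v₀) (trans split (++-identityʳ _))) at-v)
    by-split (a ∷ A , b ∷ B , split , at-v) = (b ∷ B) ++ (a ∷ A) ,
      subst (λ w → CycleAt w ((b ∷ B) ++ (a ∷ A))) at-v
        (CycleAt-rotate (a ∷ A) (subst (CycleAt v₀) split (Cycle⇒CycleAt cyc))) ,
      (λ ()) ,
      subst id (sym (SmoothInto-++ˡ (b ∷ B) a A (proj₁ b))) λ cusp →
        no-cusp (lastEdge a A , proj₁ b , ∈-++⁺ˡ (subst₂ (λ L w → (lastEdge a A , w , proj₁ b) ∈ innerTurns G c L) (sym split) at-v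
                                                    (join∈innerTurns a A b B)) ,
                 subst (λ w → Cusp (lastEdge a A) w (proj₁ b)) at-v cusp)

  v-splitting : Splitting G c v
  v-splitting (mkPath v₀ cs) cyc v∈ with cuspAt? v (mkPath v₀ cs)
  ... | yes cusp-at-v = cusp-at-v
  ... | no  no-cusp with rooted v₀ cs cyc v∈ no-cusp
  ...   | L , cyc′ , nonempty , smooth = ⊥-elim (smooth-cycle-impossible L cyc′ nonempty smooth)

proposition3p5 : (G : PartialGraph) (k : ℕ) (c : Coloring G k) →
    NoCuspFreeCycle G c →
    (v : Fin (nV G)) → ¬ Splitting G c v →
    (α : Fin k) →
    ∃[ u ] ∃[ β ] (CuspPoint G c u β × Lhd G c v α u β)
proposition3p5 G k c no-cusp-free-cycle v not-splitting α with Decision.target? G c v α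
... | yes target    = target
... | no  no-target = ⊥-elim (not-splitting (Rerouting.v-splitting G c no-cusp-free-cycle v α no-target))
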